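{- Let $M$ be an $m\times n$ grid graph with $m,n\geq 3$, $N=mn$ nodes and positive integer node weights $w_{ij}$ of total weight $W$, such that no node has weight at least $W/2$. Let $0<\rho<1$, $r=\rho W/(3N)$ and $w'_{ij}=\lfloor w_{ij}/r\rfloor$. Let $(V_0,V_1)$ be a connected bipartition maximizing $\min\{w'(V_0),w'(V_1)\}$ and let $(V_0^*,V_1^*)$ be a connected bipartition maximizing $\min\{w(V_0^*),w(V_1^*)\}$. Then $\frac{\min\{w(V_0^*),w(V_1^*)\}}{\min\{w(V_0),w(V_1)\}}\leq\frac{1}{1-\rho}$.
   Context: The grid graph has node set $\{M_{ij}\}$ with edges between nodes consecutive in a row or a column. For a weight function $x$ and a node set $S$, $x(S)$ is the sum of $x$ over $S$. A connected bipartition is a partition of the node set into two nonempty parts each inducing a connected subgraph. -}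

module Defs where

open import Data.Nat as ℕ using (ℕ)
open import Data.Integer as ℤ using (ℤ; +_)
open import Data.Rational as ℚ using (ℚ; 0ℚ; _÷_; floor; ≢-nonZero)
open import Data.Fin using (Fin; toℕ)
open import Data.Bool using (Bool; true; false; _≟_)
open import Data.Nat.ListAction using (sum)
open import Data.List using (List; map; allFin; concatMap; filter)
open import Data.Product using (_×_; _,_; Σ; ∃)
open import Data.Sum using (_⊎_)
open import Relation.Binary.PropositionalEquality using (_≡_)
open import Relation.Nullary using (yes; no)

Node : ℕ → ℕ → Set
Node m n = Fin m × Fin n

Consec : {k : ℕ} → Fin k → Fin k → Set
Consec a b = ℕ.suc (toℕ a) ≡ toℕ b ⊎ ℕ.suc (toℕ b) ≡ toℕ a

Adj : {m n : ℕ} → Node m n → Node m n → Set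
Adj (i , j) (i' , j') = (i ≡ i' × Consec j j') ⊎ (j ≡ j' × Consec i i')

-- A bipartition of the node set is a colouring  P : Node m n → Bool ;
-- V_0 = { v | P v ≡ false } ,  V_1 = { v | P v ≡ true }.

Bipartition : ℕ → ℕ → Set
Bipartition m n = Node m n → Bool

data PathIn {m n : ℕ} (P : Bipartition m n) (b : Bool) :
            Node m n → Node m n → Set where
  here : ∀ {u} → P u ≡ b → PathIn P b u u
  step : ∀ {u v w} → P u ≡ b → Adj u v → PathIn P b v w → PathIn P b u w

ConnectedNonemptyPart : {m n : ℕ} → Bipartition m n → Bool → Set
ConnectedNonemptyPart {m} {n} P b =
  Σ (Node m n) (λ v → P v ≡ b) ×
  ((u v : Node m n) → P u ≡ b → P v ≡ b → PathIn P b u v)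

ConnectedBipartition : {m n : ℕ} → Bipartition m n → Set
ConnectedBipartition P = ConnectedNonemptyPart P false × ConnectedNonemptyPart P true

allNodes : (m n : ℕ) → List (Node m n)
allNodes m n = concatMap (λ i → map (λ j → (i , j)) (allFin n)) (allFin m)

weightℕ : {m n : ℕ} → (Node m n → ℕ) → Bipartition m n → Bool → ℕ
weightℕ {m} {n} x P b = sum (map x (filter (λ v → P v ≟ b) (allNodes m n)))

weightℤ : {m n : ℕ} → (Node m n → ℤ) → Bipartition m n → Bool → ℤ
weightℤ {m} {n} x P b =
  Data.List.foldr ℤ._+_ (+ 0) (map x (filter (λ v → P v ≟ b) (allNodes m n)))

totalWeight : {m n : ℕ} → (Node m n → ℕ) → ℕ
totalWeight {m} {n} x = sum (map x (allNodes m n))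

minWeightℕ : {m n : ℕ} → (Node m n → ℕ) → Bipartition m n → ℕ
minWeightℕ x P = weightℕ x P false ℕ.⊓ weightℕ x P true

minWeightℤ : {m n : ℕ} → (Node m n → ℤ) → Bipartition m n → ℤ
minWeightℤ x P = weightℤ x P false ℤ.⊓ weightℤ x P true

ℕtoℚ : ℕ → ℚ
ℕtoℚ k = (+ k) ℚ./ 1

-- total division on ℚ (p / q ; the value for q = 0 is irrelevant and
-- never used below, since r > 0 in the theorem)
divℚ : ℚ → ℚ → ℚ
divℚ p q with q ℚ.≟ 0ℚ
... | yes _  = 0ℚ
... | no q≢0 = _÷_ p q {{≢-nonZero q≢0}}

scale : ℚ → ℕ → ℕ → ℚ
scale ρ W N = divℚ (ρ ℚ.* ℕtoℚ W) (ℕtoℚ (3 ℕ.* N))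

rounded : {m n : ℕ} → (Node m n → ℕ) → ℚ → Node m n → ℤ
rounded w r v = floor (divℚ (ℕtoℚ (w v)) r)

module Submission where

-- Write OPT = min w(V*), r = ρW/(3N) and w' = ⌊w/r⌋.  The proof combines
-- three facts.
--  (1) A balanced cut: OPT ≥ W/3.  List the nodes in row-major order and
--      scan prefixes: either some prefix/suffix split leaves at least W/3
--      on both sides (prefixes and suffixes of this order are connected),
--      or a single node u weighs at least W/3; then ({u}ᶜ, {u}) is a
--      connected bipartition (the grid has ≥ 2 rows and columns) and,
--      since 2w(u) < W, both of its sides weigh at least W/3.
--  (2) Rounding bounds: for every list S of nodes,
--      r·w'(S) ≤ w(S) ≤ r·w'(S) + r·|S|.
--  (3) Comparison: with c the lighter side of V* for w' and b the lighter
--      side of V for w,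
--        OPT ≤ w(V*_c) ≤ r·w'(V*_c) + rN ≤ r·w'(V_b) + rN ≤ w(V_b) + rN,
--      and rN = ρW/3 ≤ ρ·OPT by (1).  Hence (1-ρ)·OPT ≤ min w(V).

open import Defs
open import Data.Nat using (ℕ)
open import Data.Fin using (Fin)
open import Data.Bool using (Bool; true; false; not)
open import Data.Bool.Properties using () renaming (_≟_ to _≟B_)
open import Data.List using (List; []; _∷_; filter)
open import Data.Product using (_×_; _,_; Σ; proj₁; proj₂)
open import Data.Sum using (_⊎_; inj₁; inj₂)
open import Data.Empty using (⊥-elim)
open import Relation.Binary.PropositionalEquality
open import Relation.Nullary using (¬_; Dec; yes; no; does)

does-true : {A : Set} (a? : Dec A) → does a? ≡ true → A
does-true (yes a) _ = a
does-true (no _) ()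

does-false : {A : Set} (a? : Dec A) → does a? ≡ false → ¬ A
does-false (no ¬a) _ = ¬a
does-false (yes _) ()

side : {X : Set} → (X → Bool) → Bool → List X → List X
side P b = filter (λ v → P v ≟B b)

Consec-sym : {k : ℕ} {a c : Fin k} → Consec a c → Consec c a
Consec-sym (inj₁ e) = inj₂ e
Consec-sym (inj₂ e) = inj₁ e

Adj-sym : {m n : ℕ} {u v : Node m n} → Adj u v → Adj v u
Adj-sym (inj₁ (e , c)) = inj₁ (sym e , Consec-sym c)
Adj-sym (inj₂ (e , c)) = inj₂ (sym e , Consec-sym c)

module Sides {X : Set} (P : X → Bool) where
  open import Data.Nat using (_+_)
  open import Data.Nat.Properties using (+-assoc; +-comm)
  open import Data.Nat.ListAction using (sum)
  open import Data.List using (map)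

  side-keeps : ∀ b u xs → P u ≡ b → side P b (u ∷ xs) ≡ u ∷ side P b xs
  side-keeps false u xs e rewrite e = refl
  side-keeps true u xs e rewrite e = refl

  side-drops : ∀ b u xs → P u ≡ not b → side P b (u ∷ xs) ≡ side P b xs
  side-drops false u xs e rewrite e = refl
  side-drops true u xs e rewrite e = refl

  sides-sum : (w : X → ℕ) → ∀ xs →
    sum (map w (side P false xs)) + sum (map w (side P true xs)) ≡ sum (map w xs)
  sides-sum w [] = refl
  sides-sum w (u ∷ xs) with P u
  ... | false =
    trans (+-assoc (w u) _ _) (cong (w u +_) (sides-sum w xs))
  ... | true =
    trans (sym (+-assoc F (w u) T))
      (trans (cong (_+ T) (+-comm F (w u)))
        (trans (+-assoc (w u) F T) (cong (w u +_) (sides-sum w xs))))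
    where
    F = sum (map w (side P false xs))
    T = sum (map w (side P true xs))

module Walks {m n : ℕ} (P : Bipartition m n) (b : Bool) where
  open import Data.Nat using (_<_)
  open import Data.Nat.Induction using (<-wellFounded)
  open import Induction.WellFounded using (Acc; acc)

  walk-source : ∀ {u v} → PathIn P b u v → P u ≡ b
  walk-source (here p) = p
  walk-source (step p _ _) = p

  _++ʷ_ : ∀ {u v w} → PathIn P b u v → PathIn P b v w → PathIn P b u w
  here _ ++ʷ q = q
  step p a r ++ʷ q = step p a (r ++ʷ q)

  reverseʷ : ∀ {u v} → PathIn P b u v → PathIn P b v u
  reverseʷ (here p) = here p
  reverseʷ (step p a q) = reverseʷ q ++ʷ step (walk-source q) (Adj-sym a) (here p)

  Descent : Node m n → (Node m n → ℕ) → Set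
  Descent r μ = ∀ u → P u ≡ b →
    u ≡ r ⊎ Σ (Node m n) (λ v → P v ≡ b × Adj u v × μ v < μ u)

  descent⇒walk : ∀ {r μ} → Descent r μ → ∀ u → P u ≡ b → PathIn P b u r
  descent⇒walk {r} {μ} desc u pu = go u pu (<-wellFounded (μ u))
    where
    go : ∀ u → P u ≡ b → Acc _<_ (μ u) → PathIn P b u r
    go u pu (acc smaller) with desc u pu
    ... | inj₁ refl = here pu
    ... | inj₂ (v , pv , u~v , μv<μu) = step pu u~v (go v pv (smaller μv<μu))

  descent⇒connected : ∀ {r μ} → P r ≡ b → Descent r μ → ConnectedNonemptyPart P b
  descent⇒connected {r} pr desc =
    (r , pr) , λ u v pu pv → descent⇒walk desc u pu ++ʷ reverseʷ (descent⇒walk desc v pv)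

open Walks using (Descent; descent⇒connected)

-- The grid with suc m' rows and suc n' columns, ordered row by row.
module RowMajor (m' n' : ℕ) where
  open import Data.Nat using (zero; suc; _+_; _*_; _∸_; _≤_; _<_; z≤n; s≤s; _≤?_; _<?_)
  open import Data.Nat.Properties
  open import Data.Fin using (zero; suc; toℕ; inject₁; fromℕ; fromℕ<) renaming (_≟_ to _≟ᶠ_)
  open import Data.Fin.Properties
    using (toℕ-inject₁; toℕ-fromℕ; toℕ-fromℕ<; toℕ-injective; toℕ<n) renaming (0≢1+n to zero≢suc)
  open import Data.Product.Properties using (≡-dec)
  open import Relation.Binary.Definitions using (DecidableEquality)
  open import Relation.Nullary.Decidable using (dec-true; dec-false)

  m n : ℕ
  m = suc m'
  n = suc n'

  idx : Node m n → ℕ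
  idx (i , j) = toℕ i * n + toℕ j

  last : ℕ
  last = m' * n + n'

  idx≤last : ∀ u → idx u ≤ last
  idx≤last (i , j) = +-mono-≤ (*-monoˡ-≤ n (<⇒≤pred (toℕ<n i))) (<⇒≤pred (toℕ<n j))

  origin corner : Node m n
  origin = zero , zero
  corner = fromℕ m' , fromℕ n'

  idx-corner : idx corner ≡ last
  idx-corner = cong₂ (λ a b → a * n + b) (toℕ-fromℕ m') (toℕ-fromℕ n')

  not-below-max : ∀ {k} (x : Fin (suc k)) → ¬ toℕ x < k → x ≡ fromℕ k
  not-below-max {k} x x≮k =
    toℕ-injective (trans (≤-antisym (<⇒≤pred (toℕ<n x)) (≮⇒≥ x≮k)) (sym (toℕ-fromℕ k)))

  record Earlier (u v : Node m n) : Set where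
    constructor earlier
    field
      adj : Adj u v
      before : idx v < idx u

  record Later (u v : Node m n) : Set where
    constructor later
    field
      adj : Adj u v
      after : idx u < idx v

  toLeft : ∀ i j' → Earlier (i , suc j') (i , inject₁ j')
  toLeft i j' = earlier (inj₁ (refl , inj₂ (cong suc (toℕ-inject₁ j'))))
    (subst (λ x → toℕ i * n + x < toℕ i * n + suc (toℕ j')) (sym (toℕ-inject₁ j'))
      (+-monoʳ-< (toℕ i * n) (n<1+n (toℕ j'))))

  toAbove : ∀ i' j → Earlier (suc i' , j) (inject₁ i' , j)
  toAbove i' j = earlier (inj₂ (refl , inj₂ (cong suc (toℕ-inject₁ i'))))
    (subst (λ x → x * n + toℕ j < n + toℕ i' * n + toℕ j) (sym (toℕ-inject₁ i'))
      (+-monoˡ-< (toℕ j) (m<n+m (toℕ i' * n) (s≤s z≤n))))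

  toRight : ∀ i j (j<n' : toℕ j < n') → Later (i , j) (i , fromℕ< (s≤s j<n'))
  toRight i j j<n' = later (inj₁ (refl , inj₁ (sym (toℕ-fromℕ< (s≤s j<n')))))
    (subst (λ x → toℕ i * n + toℕ j < toℕ i * n + x) (sym (toℕ-fromℕ< (s≤s j<n')))
      (+-monoʳ-< (toℕ i * n) (n<1+n (toℕ j))))

  toBelow : ∀ i j (i<m' : toℕ i < m') → Later (i , j) (fromℕ< (s≤s i<m') , j)
  toBelow i j i<m' = later (inj₂ (refl , inj₁ (sym (toℕ-fromℕ< (s≤s i<m')))))
    (subst (λ x → toℕ i * n + toℕ j < x * n + toℕ j) (sym (toℕ-fromℕ< (s≤s i<m')))
      (+-monoˡ-< (toℕ j) (m<n+m (toℕ i * n) (s≤s z≤n))))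

  predecessor : ∀ u → u ≡ origin ⊎ Σ (Node m n) (Earlier u)
  predecessor (i , suc j') = inj₂ (_ , toLeft i j')
  predecessor (suc i' , zero) = inj₂ (_ , toAbove i' zero)
  predecessor (zero , zero) = inj₁ refl

  successor : ∀ u → u ≡ corner ⊎ Σ (Node m n) (Later u)
  successor (i , j) with toℕ j <? n' | toℕ i <? m'
  ... | yes j<n' | _ = inj₂ (_ , toRight i j j<n')
  ... | no _ | yes i<m' = inj₂ (_ , toBelow i j i<m')
  ... | no j≮n' | no i≮m' = inj₁ (cong₂ _,_ (not-below-max i i≮m') (not-below-max j j≮n'))

  toCorner : Node m n → ℕ
  toCorner u = last ∸ idx u

  toCorner-< : ∀ u v → idx u < idx v → toCorner v < toCorner u
  toCorner-< u v lt = ∸-monoʳ-< lt (idx≤last v)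

  initial-connected : (P : Bipartition m n) (b : Bool) → P origin ≡ b →
    (∀ u v → idx v < idx u → P u ≡ b → P v ≡ b) → ConnectedNonemptyPart P b
  initial-connected P b p₀ closed = descent⇒connected P b p₀ descent
    where
    descent : Descent P b origin idx
    descent u pu with predecessor u
    ... | inj₁ e = inj₁ e
    ... | inj₂ (v , earlier u~v v<u) = inj₂ (v , closed u v v<u pu , u~v , v<u)

  final-connected : (P : Bipartition m n) (b : Bool) → P corner ≡ b →
    (∀ u v → idx u < idx v → P u ≡ b → P v ≡ b) → ConnectedNonemptyPart P b
  final-connected P b p₁ closed = descent⇒connected P b p₁ descent
    where
    descent : Descent P b corner toCorner
    descent u pu with successor u
    ... | inj₁ e = inj₁ e
    ... | inj₂ (v , later u~v u<v) = inj₂ (v , closed u v u<v pu , u~v , toCorner-< u v u<v)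

  threshold : ℕ → Bipartition m n
  threshold k v = does (k ≤? idx v)

  threshold-false : ∀ k v → threshold k v ≡ false → idx v < k
  threshold-false k v e = ≰⇒> (does-false (k ≤? idx v) e)

  threshold-true : ∀ k v → threshold k v ≡ true → k ≤ idx v
  threshold-true k v e = does-true (k ≤? idx v) e

  below-threshold : ∀ k v → idx v < k → threshold k v ≡ false
  below-threshold k v lt = dec-false (k ≤? idx v) (<⇒≱ lt)

  above-threshold : ∀ k v → k ≤ idx v → threshold k v ≡ true
  above-threshold k v le = dec-true (k ≤? idx v) le

  threshold-connected : ∀ k → 0 < k → k ≤ last → ConnectedBipartition (threshold k)
  threshold-connected k 0<k k≤last =
    initial-connected _ false (below-threshold k origin 0<k)
      (λ u v v<u pu → below-threshold k v (<-trans v<u (threshold-false k u pu))) ,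
    final-connected _ true (above-threshold k corner (subst (k ≤_) (sym idx-corner) k≤last))
      (λ u v u<v pu → above-threshold k v (≤-trans (threshold-true k u pu) (<⇒≤ u<v)))

  _≟ₙ_ : DecidableEquality (Node m n)
  _≟ₙ_ = ≡-dec _≟ᶠ_ _≟ᶠ_

  singleton : Node m n → Bipartition m n
  singleton c v = does (v ≟ₙ c)

  in-singleton : ∀ c v → singleton c v ≡ true → v ≡ c
  in-singleton c v = does-true (v ≟ₙ c)

  avoids : ∀ c v → v ≢ c → singleton c v ≡ false
  avoids c v = dec-false (v ≟ₙ c)

  rows-differ : ∀ {u v : Node m n} → toℕ (proj₁ u) ≢ toℕ (proj₁ v) → u ≢ v
  rows-differ ne e = ne (cong (λ x → toℕ (proj₁ x)) e)

  cols-differ : ∀ {u v : Node m n} → toℕ (proj₂ u) ≢ toℕ (proj₂ v) → u ≢ v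
  cols-differ ne e = ne (cong (λ x → toℕ (proj₂ x)) e)

  forward-avoiding : ∀ c {u} v → v ≢ c → Later u v →
    Σ (Node m n) (λ v → singleton c v ≡ false × Adj u v × toCorner v < toCorner u)
  forward-avoiding c {u} v v≢c (later u~v u<v) = v , avoids c v v≢c , u~v , toCorner-< u v u<v

  backward-avoiding : ∀ c {u} v → v ≢ c → Earlier u v →
    Σ (Node m n) (λ v → singleton c v ≡ false × Adj u v × idx v < idx u)
  backward-avoiding c v v≢c (earlier u~v v<u) = v , avoids c v v≢c , u~v , v<u

  singleton-connected : ∀ c → ConnectedNonemptyPart (singleton c) true
  singleton-connected c = (c , dec-true (c ≟ₙ c) refl) , λ u v pu pv →
    subst₂ (PathIn (singleton c) true) (sym (in-singleton c u pu)) (sym (in-singleton c v pv))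
      (here (dec-true (c ≟ₙ c) refl))

  -- The walk is chosen according to where c lies:
  --  * c off the first row and column: walk back to the origin, going up
  --    instead of left when the left neighbour is c;
  --  * c in the first row: walk down to the second row, then forward;
  --  * c in the first column (not the origin): walk forward, never entering
  --    column 0.
  complement-interior : ∀ a b → Descent (singleton (suc a , suc b)) false origin idx
  complement-interior a b (zero , zero) _ = inj₁ refl
  complement-interior a b (suc i' , zero) _ =
    inj₂ (backward-avoiding (suc a , suc b) _ (λ e → zero≢suc (cong proj₂ e)) (toAbove i' zero))
  complement-interior a b (zero , suc j') _ =
    inj₂ (backward-avoiding (suc a , suc b) _ (λ e → zero≢suc (cong proj₁ e)) (toLeft zero j'))
  complement-interior a b (suc i' , suc j') _ with (suc i' , inject₁ j') ≟ₙ (suc a , suc b)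
  ... | no left≢c = inj₂ (backward-avoiding (suc a , suc b) _ left≢c (toLeft (suc i') j'))
  ... | yes left≡c = inj₂ (backward-avoiding (suc a , suc b) _ above≢c (toAbove i' (suc j')))
    where
    -- above and left of u are two different nodes of column c
    above≢c : (inject₁ i' , suc j') ≢ (suc a , suc b)
    above≢c e = 1+n≢n (trans (cong toℕ (trans (cong proj₂ e) (sym (cong proj₂ left≡c))))
                             (toℕ-inject₁ j'))

  first-row-early : ∀ i' j b → idx (zero , b) < idx (suc i' , j)
  first-row-early i' j b = <-≤-trans (toℕ<n b) (≤-trans (m≤m+n n (toℕ i' * n)) (m≤m+n _ (toℕ j)))

  complement-first-row : 0 < m' → ∀ b → Descent (singleton (zero , b)) false corner toCorner
  complement-first-row 0<m' b (zero , j) _ =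
    inj₂ (forward-avoiding (zero , b) _ (rows-differ (λ e → 1+n≢0 (trans (sym (toℕ-fromℕ< (s≤s 0<m'))) e)))
                           (toBelow zero j 0<m'))
  complement-first-row 0<m' b (suc i' , j) _ with successor (suc i' , j)
  ... | inj₁ e = inj₁ e
  ... | inj₂ (v , u<v) =
    inj₂ (forward-avoiding (zero , b) _
            (λ { refl → <-asym (Later.after u<v) (first-row-early i' j b) }) u<v)

  complement-first-column : 0 < n' → ∀ a → Descent (singleton (suc a , zero)) false corner toCorner
  complement-first-column 0<n' a (i , j) _ with toℕ j <? n' | toℕ i <? m'
  ... | yes j<n' | _ = inj₂ (forward-avoiding (suc a , zero) _
          (cols-differ (λ e → 1+n≢0 (trans (sym (toℕ-fromℕ< (s≤s j<n'))) e))) (toRight i j j<n'))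
  ... | no j≮n' | yes i<m' = inj₂ (forward-avoiding (suc a , zero) _
          (cols-differ (λ e → j≮n' (subst (_< n') (sym e) 0<n'))) (toBelow i j i<m'))
  ... | no j≮n' | no i≮m' = inj₁ (cong₂ _,_ (not-below-max i i≮m') (not-below-max j j≮n'))

  complement-connected : 0 < m' → 0 < n' → ∀ c → ConnectedNonemptyPart (singleton c) false
  complement-connected _ _ (suc a , suc b) =
    descent⇒connected _ false (avoids (suc a , suc b) origin (λ e → zero≢suc (cong proj₁ e)))
      (complement-interior a b)
  complement-connected 0<m' _ (zero , b) =
    descent⇒connected _ false (avoids (zero , b) corner corner-off-first-row) (complement-first-row 0<m' b)
    where
    corner-off-first-row : corner ≢ (zero , b)
    corner-off-first-row = rows-differ (λ e → <-irrefl (trans (sym e) (toℕ-fromℕ m')) 0<m')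
  complement-connected _ 0<n' (suc a , zero) =
    descent⇒connected _ false (avoids (suc a , zero) corner corner-off-first-column)
      (complement-first-column 0<n' a)
    where
    corner-off-first-column : corner ≢ (suc a , zero)
    corner-off-first-column = cols-differ (λ e → <-irrefl (trans (sym e) (toℕ-fromℕ n')) 0<n')

  singleton-bipartition : 0 < m' → 0 < n' → ∀ c → ConnectedBipartition (singleton c)
  singleton-bipartition 0<m' 0<n' c = complement-connected 0<m' 0<n' c , singleton-connected c

module Counting where
  open import Data.Nat using (zero; suc; _+_; _*_)
  open import Data.Fin using (zero; suc)
  open import Data.List using (map; tabulate; length; allFin; concatMap)
  open import Data.List.Properties using (length-map; length-tabulate; length-++)
  open import Data.List.Membership.Propositional using (_∈_)
  open import Data.List.Membership.Propositional.Properties using (∈-map⁺; ∈-tabulate⁺; ∈-concat⁺′)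

  row : ∀ {m} n → Fin m → List (Node m n)
  row n i = map (i ,_) (allFin n)

  length-row : ∀ {m} n (i : Fin m) → length (row n i) ≡ n
  length-row n i = trans (length-map _ (allFin n)) (length-tabulate (λ x → x))

  length-allNodes : ∀ m n → length (allNodes m n) ≡ m * n
  length-allNodes m n = length-rows m (λ x → x)
    where
    length-rows : ∀ k (h : Fin k → Fin m) → length (concatMap (row n) (tabulate h)) ≡ k * n
    length-rows zero h = refl
    length-rows (suc k) h = trans (length-++ (row n (h zero)))
      (cong₂ _+_ (length-row n (h zero)) (length-rows k (λ x → h (suc x))))

  ∈-allNodes : ∀ {m n} (u : Node m n) → u ∈ allNodes m n
  ∈-allNodes (i , j) = ∈-concat⁺′ (∈-map⁺ (i ,_) (∈-tabulate⁺ {f = λ x → x} j))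
                                  (∈-map⁺ (row _) (∈-tabulate⁺ {f = λ x → x} i))

open Counting

module Enumeration (m' n' : ℕ) where
  open RowMajor m' n'
  open Sides
  open import Data.Nat using (zero; suc; _+_; _*_; _∸_; _≤_; _<_; _≤?_)
  open import Data.Nat.Properties
  open import Data.Fin using (zero; suc; toℕ)
  open import Data.List using (_++_; map; take; drop; tabulate; length; concatMap)
  open import Data.List.Relation.Unary.Any using (here; there)
  open import Data.List.Membership.Propositional using (_∈_)
  open import Data.Unit using (⊤; tt)
  open import Relation.Nullary.Decidable using (dec-true)

  Consecutive : ℕ → List (Node m n) → Set
  Consecutive s [] = ⊤
  Consecutive s (u ∷ xs) = idx u ≡ s × Consecutive (suc s) xs

  consecutive-++ : ∀ s xs ys → Consecutive s xs → Consecutive (s + length xs) ys →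
    Consecutive s (xs ++ ys)
  consecutive-++ s [] ys _ c = subst (λ z → Consecutive z ys) (+-identityʳ s) c
  consecutive-++ s (u ∷ xs) ys (e , c₁) c₂ =
    e , consecutive-++ (suc s) xs ys c₁ (subst (λ z → Consecutive z ys) (+-suc s (length xs)) c₂)

  columns-consecutive : ∀ k (f : Fin k → Fin n) t i s → s ≡ toℕ i * n + t →
    (∀ x → toℕ (f x) ≡ t + toℕ x) → Consecutive s (map (i ,_) (tabulate f))
  columns-consecutive zero f t i s _ _ = tt
  columns-consecutive (suc k) f t i s s≡ hf =
    trans (cong (toℕ i * n +_) (trans (hf zero) (+-identityʳ t))) (sym s≡) ,
    columns-consecutive k (λ x → f (suc x)) (suc t) i (suc s)
      (trans (cong suc s≡) (sym (+-suc _ t))) (λ x → trans (hf (suc x)) (+-suc t (toℕ x)))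

  rows-consecutive : ∀ k (h : Fin k → Fin m) t s → s ≡ t * n →
    (∀ x → toℕ (h x) ≡ t + toℕ x) → Consecutive s (concatMap (row n) (tabulate h))
  rows-consecutive zero h t s _ _ = tt
  rows-consecutive (suc k) h t s s≡ hh =
    consecutive-++ s (row n (h zero)) _
      (columns-consecutive n (λ x → x) 0 (h zero) s
        (trans s≡ (trans (sym (+-identityʳ _)) (cong (λ z → z * n + 0) (sym (trans (hh zero) (+-identityʳ t))))))
        (λ x → refl))
      (rows-consecutive k (λ x → h (suc x)) (suc t) _
        (trans (cong (s +_) (length-row n (h zero))) (trans (cong (_+ n) s≡) (+-comm (t * n) n)))
        (λ x → trans (hh (suc x)) (+-suc t (toℕ x))))

  allNodes-consecutive : Consecutive 0 (allNodes m n)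
  allNodes-consecutive = rows-consecutive m (λ x → x) 0 0 refl (λ x → refl)

  consecutive-≥ : ∀ {s xs v} → Consecutive s xs → v ∈ xs → s ≤ idx v
  consecutive-≥ {xs = u ∷ xs} (e , _) (here refl) = ≤-reflexive (sym e)
  consecutive-≥ {s} {xs = u ∷ xs} (_ , c) (there v∈xs) = ≤-trans (n≤1+n s) (consecutive-≥ c v∈xs)

  ∸-step : ∀ k s → s < k → k ∸ s ≡ suc (k ∸ suc s)
  ∸-step k s s<k = +-∸-assoc 1 s<k

  head-after : ∀ k s u → idx u ≡ s → k ≤ s → threshold k u ≡ true
  head-after k s u e k≤s = above-threshold k u (subst (k ≤_) (sym e) k≤s)

  head-before : ∀ k s u → idx u ≡ s → ¬ k ≤ s → threshold k u ≡ false
  head-before k s u e k≰s = below-threshold k u (subst (_< k) (sym e) (≰⇒> k≰s))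

  threshold-first-side : ∀ k s xs → Consecutive s xs →
    side (threshold k) false xs ≡ take (k ∸ s) xs
  threshold-first-side k s [] _ with k ∸ s
  ... | zero = refl
  ... | suc _ = refl
  threshold-first-side k s (u ∷ xs) (e , c) with k ≤? s
  ... | yes k≤s = begin
    side (threshold k) false (u ∷ xs) ≡⟨ side-drops (threshold k) false u xs (head-after k s u e k≤s) ⟩
    side (threshold k) false xs       ≡⟨ threshold-first-side k (suc s) xs c ⟩
    take (k ∸ suc s) xs               ≡⟨ cong (λ z → take z xs) (m≤n⇒m∸n≡0 (m≤n⇒m≤1+n k≤s)) ⟩
    []                                ≡⟨ cong (λ z → take z (u ∷ xs)) (sym (m≤n⇒m∸n≡0 k≤s)) ⟩
    take (k ∸ s) (u ∷ xs)             ∎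
    where open ≡-Reasoning
  ... | no k≰s = begin
    side (threshold k) false (u ∷ xs) ≡⟨ side-keeps (threshold k) false u xs (head-before k s u e k≰s) ⟩
    u ∷ side (threshold k) false xs   ≡⟨ cong (u ∷_) (threshold-first-side k (suc s) xs c) ⟩
    take (suc (k ∸ suc s)) (u ∷ xs)   ≡⟨ cong (λ z → take z (u ∷ xs)) (sym (∸-step k s (≰⇒> k≰s))) ⟩
    take (k ∸ s) (u ∷ xs)             ∎
    where open ≡-Reasoning

  threshold-second-side : ∀ k s xs → Consecutive s xs →
    side (threshold k) true xs ≡ drop (k ∸ s) xs
  threshold-second-side k s [] _ with k ∸ s
  ... | zero = refl
  ... | suc _ = refl
  threshold-second-side k s (u ∷ xs) (e , c) with k ≤? s
  ... | yes k≤s = begin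
    side (threshold k) true (u ∷ xs) ≡⟨ side-keeps (threshold k) true u xs (head-after k s u e k≤s) ⟩
    u ∷ side (threshold k) true xs   ≡⟨ cong (u ∷_) (threshold-second-side k (suc s) xs c) ⟩
    u ∷ drop (k ∸ suc s) xs          ≡⟨ cong (λ z → u ∷ drop z xs) (m≤n⇒m∸n≡0 (m≤n⇒m≤1+n k≤s)) ⟩
    u ∷ xs                           ≡⟨ cong (λ z → drop z (u ∷ xs)) (sym (m≤n⇒m∸n≡0 k≤s)) ⟩
    drop (k ∸ s) (u ∷ xs)            ∎
    where open ≡-Reasoning
  ... | no k≰s = begin
    side (threshold k) true (u ∷ xs) ≡⟨ side-drops (threshold k) true u xs (head-before k s u e k≰s) ⟩
    side (threshold k) true xs       ≡⟨ threshold-second-side k (suc s) xs c ⟩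
    drop (suc (k ∸ suc s)) (u ∷ xs)  ≡⟨ cong (λ z → drop z (u ∷ xs)) (sym (∸-step k s (≰⇒> k≰s))) ⟩
    drop (k ∸ s) (u ∷ xs)            ∎
    where open ≡-Reasoning

  singleton-side-absent : ∀ c s xs → Consecutive s xs → idx c < s → side (singleton c) true xs ≡ []
  singleton-side-absent c s [] _ _ = refl
  singleton-side-absent c s (u ∷ xs) (e , cs) c<s =
    trans (side-drops (singleton c) true u xs (avoids c u (λ { refl → <-irrefl e c<s })))
      (singleton-side-absent c (suc s) xs cs (m<n⇒m<1+n c<s))

  singleton-side : ∀ c s xs → Consecutive s xs → c ∈ xs → side (singleton c) true xs ≡ c ∷ []
  singleton-side c s (u ∷ xs) (e , cs) (here refl) =
    trans (side-keeps (singleton c) true c xs (dec-true (c ≟ₙ c) refl))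
      (cong (c ∷_) (singleton-side-absent c (suc s) xs cs (subst (_< suc s) (sym e) ≤-refl)))
  singleton-side c s (u ∷ xs) (e , cs) (there c∈xs) =
    trans (side-drops (singleton c) true u xs
            (avoids c u (λ { refl → <-irrefl (sym e) (consecutive-≥ cs c∈xs) })))
      (singleton-side c (suc s) xs cs c∈xs)

module ListCut {X : Set} (w : X → ℕ) (W : ℕ) where
  open import Data.Nat using (suc; _+_; _*_; _≤_; _<_; z≤n; s≤s; _≤?_)
  open import Data.Nat.Properties
  open import Data.Nat.ListAction using (sum)
  open import Data.Nat.Tactic.RingSolver using (solve-∀)
  open import Data.List using (map; take; drop)
  open import Data.List.Relation.Unary.Any using (here; there)
  open import Data.List.Membership.Propositional using (_∈_)

  weight : List X → ℕ
  weight xs = sum (map w xs)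

  -- A cut of xs after its first j ≥ 1 elements, given that weight a lies
  -- before xs: both sides weigh at least W/3 and the rest is nonempty.
  record Cut (a : ℕ) (xs : List X) : Set where
    constructor cut
    field
      position : ℕ
      position≥1 : 1 ≤ position
      front-heavy : W ≤ 3 * (a + weight (take position xs))
      back-heavy : W ≤ 3 * weight (drop position xs)
      back-element : X
      back-element∈ : back-element ∈ drop position xs

  third-part-heavy : ∀ a y z → a + (y + z) ≡ W → 3 * a < W → 3 * z < W → W ≤ 3 * y
  third-part-heavy a y z total 3a<W 3z<W = ≮⇒≥ λ 3y<W →
    <-irrefl (trans (distrib a y z) (trans (cong (3 *_) total) (triple W)))
      (+-mono-< 3a<W (+-mono-< 3y<W 3z<W))
    where
    distrib : ∀ a y z → 3 * a + (3 * y + 3 * z) ≡ 3 * (a + (y + z))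
    distrib = solve-∀
    triple : ∀ W → 3 * W ≡ W + (W + W)
    triple = solve-∀

  scan : ∀ a xs → 3 * a < W → a + weight xs ≡ W →
    Cut a xs ⊎ Σ X (λ u → u ∈ xs × W ≤ 3 * w u)
  scan a [] 3a<W total =
    ⊥-elim (<⇒≱ 3a<W (subst (_≤ 3 * a) (trans (sym (+-identityʳ a)) total) (m≤m+n a _)))
  scan a (u ∷ xs) 3a<W total with W ≤? 3 * (a + w u) | W ≤? 3 * weight xs
  scan a (u ∷ xs) 3a<W total | no front-light | _ with scan (a + w u) xs (≰⇒> front-light)
    (trans (+-assoc a (w u) (weight xs)) total)
  ... | inj₂ (v , v∈xs , heavy) = inj₂ (v , there v∈xs , heavy)
  ... | inj₁ (cut j j≥1 front back v v∈) =
    inj₁ (cut (suc j) (s≤s z≤n) (subst (λ z → W ≤ 3 * z) (+-assoc a (w u) _) front) back v v∈)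
  scan a (u ∷ xs) 3a<W total | yes _ | no back-light =
    inj₂ (u , here refl , third-part-heavy a (w u) (weight xs) total 3a<W (≰⇒> back-light))
  scan a (u ∷ []) 3a<W total | yes _ | yes back = ⊥-elim (<⇒≱ 3a<W (≤-trans back z≤n))
  scan a (u ∷ v ∷ xs) 3a<W total | yes front | yes back =
    inj₁ (cut 1 ≤-refl (subst (λ z → W ≤ 3 * (a + z)) (sym (+-identityʳ (w u))) front) back v (here refl))

module BalancedCut (m' n' : ℕ) (w : Node (ℕ.suc m') (ℕ.suc n') → ℕ) where
  open RowMajor m' n'
  open Enumeration m' n'
  open ListCut w (totalWeight w)
  open Sides using (sides-sum)
  open import Data.Nat using (_+_; _*_; _⊓_; _≤_; _<_; z≤n; s≤s)
  open import Data.Nat.Properties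
  open import Data.List.Membership.Propositional using (_∈_)
  open import Data.List.Membership.Propositional.Properties using (∈-filter⁻)

  W : ℕ
  W = totalWeight w

  min-heavy : ∀ x y → W ≤ 3 * x → W ≤ 3 * y → W ≤ 3 * (x ⊓ y)
  min-heavy x y hx hy = subst (W ≤_) (sym (*-distribˡ-⊓ 3 x y)) (⊓-glb hx hy)

  threshold-balanced : Cut 0 (allNodes m n) →
    Σ (Bipartition m n) λ P → ConnectedBipartition P × W ≤ 3 * minWeightℕ w P
  threshold-balanced (cut k k≥1 front back v v∈back) =
    threshold k , threshold-connected k k≥1 k≤last ,
    min-heavy (weight (side (threshold k) false (allNodes m n)))
              (weight (side (threshold k) true (allNodes m n)))
      (subst (λ xs → W ≤ 3 * weight xs) (sym first-side) front)
      (subst (λ xs → W ≤ 3 * weight xs) (sym second-side) back)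
    where
    first-side = threshold-first-side k 0 (allNodes m n) allNodes-consecutive
    second-side = threshold-second-side k 0 (allNodes m n) allNodes-consecutive
    -- the nonempty second side contains a node at position ≥ k
    k≤last : k ≤ last
    k≤last = ≤-trans (threshold-true k v (proj₂ (∈-filter⁻ (λ x → threshold k x ≟B true) v∈side)))
                     (idx≤last v)
      where v∈side = subst (v ∈_) (sym second-side) v∈back

  singleton-balanced : 0 < m' → 0 < n' → (∀ v → 2 * w v < W) → ∀ u → W ≤ 3 * w u →
    Σ (Bipartition m n) λ P → ConnectedBipartition P × W ≤ 3 * minWeightℕ w P
  singleton-balanced 0<m' 0<n' light u heavy =
    singleton u , singleton-bipartition 0<m' 0<n' u , min-heavy rest (weight one) rest-heavy one-heavy
    where
    one = side (singleton u) true (allNodes m n)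
    rest = weight (side (singleton u) false (allNodes m n))
    weight-one : weight one ≡ w u
    weight-one = trans (cong weight (singleton-side u 0 (allNodes m n) allNodes-consecutive (∈-allNodes u)))
                       (+-identityʳ (w u))
    one-heavy : W ≤ 3 * weight one
    one-heavy = subst (λ z → W ≤ 3 * z) (sym weight-one) heavy
    -- rest + w u = W > 2 w u, hence rest > w u
    rest>u : w u < rest
    rest>u = +-cancelʳ-< (w u) (w u) rest
      (subst (w u + w u <_) total (subst (_< W) (cong (w u +_) (+-identityʳ (w u))) (light u)))
      where
      total : W ≡ rest + w u
      total = trans (sym (sides-sum (singleton u) w (allNodes m n))) (cong (rest +_) weight-one)
    rest-heavy : W ≤ 3 * rest
    rest-heavy = ≤-trans heavy (*-monoʳ-≤ 3 (<⇒≤ rest>u))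

  balanced-bipartition : 0 < m' → 0 < n' → (∀ v → 2 * w v < W) →
    Σ (Bipartition m n) λ P → ConnectedBipartition P × W ≤ 3 * minWeightℕ w P
  balanced-bipartition 0<m' 0<n' light with scan 0 (allNodes m n) (≤-trans (s≤s z≤n) (light origin)) refl
  ... | inj₁ balanced-cut = threshold-balanced balanced-cut
  ... | inj₂ (u , _ , heavy) = singleton-balanced 0<m' 0<n' light u heavy

module RationalFacts where
  open import Data.Nat using (zero; suc) renaming (_≤_ to _≤ℕ_; _<_ to _<ℕ_; _+_ to _+ℕ_; _*_ to _*ℕ_)
  import Data.Nat.Properties as ℕₚ
  open import Data.Nat.Coprimality using (1-coprimeTo) renaming (sym to coprime-sym)
  open import Data.Integer as ℤ using (ℤ; +_; -[1+_]; +≤+; +<+)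
  import Data.Integer.Properties as ℤₚ
  open import Data.Integer.DivMod using (a≡a%n+[a/n]*n; n%d<d)
  open import Data.Rational as ℚ
    using (ℚ; mkℚ; 0ℚ; 1ℚ; _≤_; _<_; *≤*; *<*; _+_; _*_; _-_; -_; 1/_; _÷_; floor; ≢-nonZero; NonNegative; positive)
  open import Data.Rational.Properties
  open import Data.Rational.Solver using (module +-*-Solver)
  open +-*-Solver

  fromℤ : ℤ → ℚ
  fromℤ z = z ℚ./ 1

  fromℤ-normal : ∀ z → fromℤ z ≡ mkℚ z 0 (coprime-sym (1-coprimeTo ℤ.∣ z ∣))
  fromℤ-normal (+ n) = normalize-coprime (coprime-sym (1-coprimeTo n))
  fromℤ-normal -[1+ n ] = cong -_ (normalize-coprime (coprime-sym (1-coprimeTo (suc n))))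

  fromℤ-+ : ∀ a b → fromℤ (a ℤ.+ b) ≡ fromℤ a + fromℤ b
  fromℤ-+ a b rewrite fromℤ-normal a | fromℤ-normal b =
    cong fromℤ (cong₂ ℤ._+_ (sym (ℤₚ.*-identityʳ a)) (sym (ℤₚ.*-identityʳ b)))

  fromℤ-* : ∀ a b → fromℤ (a ℤ.* b) ≡ fromℤ a * fromℤ b
  fromℤ-* a b rewrite fromℤ-normal a | fromℤ-normal b = refl

  fromℤ-mono-≤ : ∀ {a b} → a ℤ.≤ b → fromℤ a ≤ fromℤ b
  fromℤ-mono-≤ {a} {b} a≤b rewrite fromℤ-normal a | fromℤ-normal b =
    *≤* (subst₂ ℤ._≤_ (sym (ℤₚ.*-identityʳ a)) (sym (ℤₚ.*-identityʳ b)) a≤b)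

  fromℤ-mono-< : ∀ {a b} → a ℤ.< b → fromℤ a < fromℤ b
  fromℤ-mono-< {a} {b} a<b rewrite fromℤ-normal a | fromℤ-normal b =
    *<* (subst₂ ℤ._<_ (sym (ℤₚ.*-identityʳ a)) (sym (ℤₚ.*-identityʳ b)) a<b)

  ℕtoℚ-+ : ∀ x y → ℕtoℚ (x +ℕ y) ≡ ℕtoℚ x + ℕtoℚ y
  ℕtoℚ-+ x y = fromℤ-+ (+ x) (+ y)

  ℕtoℚ-* : ∀ x y → ℕtoℚ (x *ℕ y) ≡ ℕtoℚ x * ℕtoℚ y
  ℕtoℚ-* x y = trans (cong fromℤ (ℤₚ.pos-* x y)) (fromℤ-* (+ x) (+ y))

  ℕtoℚ-mono-≤ : ∀ {x y} → x ≤ℕ y → ℕtoℚ x ≤ ℕtoℚ y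
  ℕtoℚ-mono-≤ x≤y = fromℤ-mono-≤ (+≤+ x≤y)

  ℕtoℚ-positive : ∀ {x} → 0 <ℕ x → 0ℚ < ℕtoℚ x
  ℕtoℚ-positive 0<x = fromℤ-mono-< (+<+ 0<x)

  -- ⌊q⌋ ≤ q ≤ ⌊q⌋ + 1, from division with remainder of numerator by denominator.
  floor-lower : ∀ q → fromℤ (floor q) ≤ q
  floor-lower q@(mkℚ num d _) rewrite fromℤ-normal (floor q) =
    *≤* (subst₂ ℤ._≤_ refl (sym (ℤₚ.*-identityʳ num))
      (subst (f ℤ.* D ℤ.≤_) (sym (a≡a%n+[a/n]*n num D)) (ℤₚ.i≤j+i (f ℤ.* D) (+ (num ℤ.% D)))))
    where
    D = + suc d
    f = num ℤ./ D

  floor-upper : ∀ q → q ≤ fromℤ (floor q) + 1ℚ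
  floor-upper q@(mkℚ num d _) = subst (q ≤_) (fromℤ-+ f (+ 1)) below-next
    where
    D = + suc d
    f = num ℤ./ D
    below-next : q ≤ fromℤ (f ℤ.+ + 1)
    below-next rewrite fromℤ-normal (f ℤ.+ + 1) =
      *≤* (subst₂ ℤ._≤_ (trans (sym (a≡a%n+[a/n]*n num D)) (sym (ℤₚ.*-identityʳ num)))
            (sym (trans (ℤₚ.*-distribʳ-+ D f (+ 1))
                   (trans (cong (λ x → f ℤ.* D ℤ.+ x) (ℤₚ.*-identityˡ D)) (ℤₚ.+-comm (f ℤ.* D) D))))
            (ℤₚ.+-monoˡ-≤ (f ℤ.* D) (+≤+ (ℕₚ.<⇒≤ (n%d<d num D)))))

  positive⇒nonzero : ∀ {q} → 0ℚ < q → q ≢ 0ℚ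
  positive⇒nonzero 0<q q≡0 = <-irrefl (sym q≡0) 0<q

  divℚ-÷ : ∀ p q (q≢0 : q ≢ 0ℚ) → divℚ p q ≡ (p ÷ q) {{≢-nonZero q≢0}}
  divℚ-÷ p q q≢0 with q ℚ.≟ 0ℚ
  ... | yes q≡0 = ⊥-elim (q≢0 q≡0)
  ... | no _ = refl

  divℚ-cancel : ∀ p q → q ≢ 0ℚ → q * divℚ p q ≡ p
  divℚ-cancel p q q≢0 rewrite divℚ-÷ p q q≢0 =
    trans (solve 3 (λ q p q⁻¹ → q :* (p :* q⁻¹) := p :* (q :* q⁻¹)) refl q p q⁻¹)
      (trans (cong (p *_) (*-inverseʳ q {{≢-nonZero q≢0}})) (*-identityʳ p))
    where q⁻¹ = (1/ q) {{≢-nonZero q≢0}}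

  divℚ-positive : ∀ {p q} → 0ℚ < p → 0ℚ < q → 0ℚ < divℚ p q
  divℚ-positive {p} {q} 0<p 0<q rewrite divℚ-÷ p q (positive⇒nonzero 0<q) =
    positive⁻¹ _ {{pos*pos⇒pos p {{positive 0<p}} _ {{1/pos⇒pos q {{positive 0<q}}}}}}

  quotient-bound : ∀ a b c → 0ℚ < b → 0ℚ < c → a * c ≤ b → divℚ a b ≤ divℚ 1ℚ c
  quotient-bound a b c 0<b 0<c ac≤b
    rewrite divℚ-÷ a b (positive⇒nonzero 0<b) | divℚ-÷ 1ℚ c (positive⇒nonzero 0<c) =
    subst₂ _≤_ lhs rhs (*-monoʳ-≤-nonNeg (b⁻¹ * c⁻¹) {{nonneg}} ac≤b)
    where
    b⁻¹ = (1/ b) {{≢-nonZero (positive⇒nonzero 0<b)}}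
    c⁻¹ = (1/ c) {{≢-nonZero (positive⇒nonzero 0<c)}}
    nonneg : NonNegative (b⁻¹ * c⁻¹)
    nonneg = pos⇒nonNeg (b⁻¹ * c⁻¹) {{pos*pos⇒pos b⁻¹ {{1/pos⇒pos b {{positive 0<b}}}}
                                                   c⁻¹ {{1/pos⇒pos c {{positive 0<c}}}}}}
    lhs : a * c * (b⁻¹ * c⁻¹) ≡ a * b⁻¹
    lhs = trans (solve 4 (λ a c b⁻¹ c⁻¹ → a :* c :* (b⁻¹ :* c⁻¹) := (a :* b⁻¹) :* (c :* c⁻¹))
                         refl a c b⁻¹ c⁻¹)
            (trans (cong ((a * b⁻¹) *_) (*-inverseʳ c {{≢-nonZero (positive⇒nonzero 0<c)}}))
                   (*-identityʳ (a * b⁻¹)))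
    rhs : b * (b⁻¹ * c⁻¹) ≡ 1ℚ * c⁻¹
    rhs = trans (solve 3 (λ b b⁻¹ c⁻¹ → b :* (b⁻¹ :* c⁻¹) := (b :* b⁻¹) :* c⁻¹) refl b b⁻¹ c⁻¹)
            (cong (_* c⁻¹) (*-inverseʳ b {{≢-nonZero (positive⇒nonzero 0<b)}}))

  absorb : ∀ O M ρ → O ≤ M + ρ * O → O * (1ℚ - ρ) ≤ M
  absorb O M ρ O≤M+ρO =
    subst₂ _≤_ (solve 2 (λ O ρ → O :- ρ :* O := O :* (con 1ℚ :- ρ)) refl O ρ)
               (solve 2 (λ M x → (M :+ x) :- x := M) refl M (ρ * O))
      (+-monoˡ-≤ (- (ρ * O)) O≤M+ρO)

  ratio-bound : ∀ O M x ρ → 0ℚ < M → ρ < 1ℚ → O ≤ M + x → x ≤ ρ * O →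
    divℚ O M ≤ divℚ 1ℚ (1ℚ - ρ)
  ratio-bound O M x ρ 0<M ρ<1 O≤M+x x≤ρO =
    quotient-bound O M (1ℚ - ρ) 0<M 0<1-ρ (absorb O M ρ (≤-trans O≤M+x (+-monoʳ-≤ M x≤ρO)))
    where
    0<1-ρ : 0ℚ < 1ℚ - ρ
    0<1-ρ = subst (_< 1ℚ - ρ) (+-inverseʳ ρ) (+-monoˡ-< (- ρ) ρ<1)

  scale-positive : ∀ ρ W N → 0ℚ < ρ → 0 <ℕ W → 0 <ℕ N → 0ℚ < scale ρ W N
  scale-positive ρ W N 0<ρ 0<W 0<N =
    divℚ-positive (positive⁻¹ _ {{pos*pos⇒pos ρ {{positive 0<ρ}} (ℕtoℚ W) {{positive (ℕtoℚ-positive 0<W)}}}})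
                  (ℕtoℚ-positive (ℕₚ.*-monoʳ-< 3 0<N))

  scale-bound : ∀ ρ W N O → 0 <ℕ N → 0ℚ < ρ → W ≤ℕ 3 *ℕ O → scale ρ W N * ℕtoℚ N ≤ ρ * ℕtoℚ O
  scale-bound ρ W N O 0<N 0<ρ W≤3O = *-cancelʳ-≤-pos (ℕtoℚ 3) (begin
    r * ℕtoℚ N * ℕtoℚ 3         ≡⟨ solve 3 (λ r x y → r :* x :* y := y :* x :* r) refl r (ℕtoℚ N) (ℕtoℚ 3) ⟩
    ℕtoℚ 3 * ℕtoℚ N * r         ≡⟨ cong (_* r) (sym (ℕtoℚ-* 3 N)) ⟩
    ℕtoℚ (3 *ℕ N) * r           ≡⟨ divℚ-cancel (ρ * ℕtoℚ W) (ℕtoℚ (3 *ℕ N)) (positive⇒nonzero (ℕtoℚ-positive 0<3N)) ⟩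
    ρ * ℕtoℚ W                  ≤⟨ *-monoˡ-≤-nonNeg ρ {{pos⇒nonNeg ρ {{positive 0<ρ}}}} (ℕtoℚ-mono-≤ W≤3O) ⟩
    ρ * ℕtoℚ (3 *ℕ O)           ≡⟨ cong (ρ *_) (ℕtoℚ-* 3 O) ⟩
    ρ * (ℕtoℚ 3 * ℕtoℚ O)       ≡⟨ solve 3 (λ ρ x y → ρ :* (y :* x) := ρ :* x :* y) refl ρ (ℕtoℚ O) (ℕtoℚ 3) ⟩
    ρ * ℕtoℚ O * ℕtoℚ 3         ∎)
    where
    open ≤-Reasoning
    r = scale ρ W N
    0<3N : 0 <ℕ 3 *ℕ N
    0<3N = ℕₚ.*-monoʳ-< 3 0<N

module Rounding {m n : ℕ} (w : Node m n → ℕ) where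
  open RationalFacts
  open import Data.Nat.ListAction using (sum)
  open import Data.Integer as ℤ using (ℤ; +_)
  open import Data.List using (map; length; foldr)
  open import Data.Rational using (ℚ; 0ℚ; 1ℚ; _≤_; _<_; _+_; _*_; NonNegative; positive)
  open import Data.Rational.Properties
  open import Data.Rational.Solver using (module +-*-Solver)
  open +-*-Solver

  -- The rounded weight w'(S) of a list S; weightℤ (rounded w r) P b is
  -- this sum over one side of P.
  rounded-sum : ℚ → List (Node m n) → ℤ
  rounded-sum r xs = foldr ℤ._+_ (+ 0) (map (rounded w r) xs)

  module _ (r : ℚ) (0<r : 0ℚ < r) where
    private
      r≥0 : NonNegative r
      r≥0 = pos⇒nonNeg r {{positive 0<r}}

      w' : Node m n → ℤ
      w' = rounded w r

    node-lower : ∀ v → r * fromℤ (w' v) ≤ ℕtoℚ (w v)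
    node-lower v = subst (r * fromℤ (w' v) ≤_) (divℚ-cancel (ℕtoℚ (w v)) r (positive⇒nonzero 0<r))
      (*-monoˡ-≤-nonNeg r {{r≥0}} (floor-lower (divℚ (ℕtoℚ (w v)) r)))

    node-upper : ∀ v → ℕtoℚ (w v) ≤ r * fromℤ (w' v) + r
    node-upper v = subst₂ _≤_ (divℚ-cancel (ℕtoℚ (w v)) r (positive⇒nonzero 0<r))
      (trans (*-distribˡ-+ r (fromℤ (w' v)) 1ℚ) (cong (λ x → r * fromℤ (w' v) + x) (*-identityʳ r)))
      (*-monoˡ-≤-nonNeg r {{r≥0}} (floor-upper (divℚ (ℕtoℚ (w v)) r)))

    list-lower : ∀ xs → r * fromℤ (rounded-sum r xs) ≤ ℕtoℚ (sum (map w xs))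
    list-lower [] = ≤-reflexive (*-zeroʳ r)
    list-lower (v ∷ xs) = subst₂ _≤_
      (sym (trans (cong (r *_) (fromℤ-+ (w' v) (rounded-sum r xs))) (*-distribˡ-+ r _ _)))
      (sym (ℕtoℚ-+ (w v) _))
      (+-mono-≤ (node-lower v) (list-lower xs))

    list-upper : ∀ xs → ℕtoℚ (sum (map w xs)) ≤ r * fromℤ (rounded-sum r xs) + r * ℕtoℚ (length xs)
    list-upper [] = ≤-reflexive (sym (trans (cong₂ _+_ (*-zeroʳ r) (*-zeroʳ r)) (+-identityˡ _)))
    list-upper (v ∷ xs) = subst₂ _≤_
      (sym (ℕtoℚ-+ (w v) _))
      (sym (trans (cong₂ (λ p q → r * p + r * q) (fromℤ-+ (w' v) (rounded-sum r xs)) (ℕtoℚ-+ 1 (length xs)))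
        (solve 4 (λ r a b l → r :* (a :+ b) :+ r :* (con 1ℚ :+ l) := (r :* a :+ r) :+ (r :* b :+ r :* l))
          refl r (fromℤ (w' v)) (fromℤ (rounded-sum r xs)) (ℕtoℚ (length xs)))))
      (+-mono-≤ (node-upper v) (list-upper xs))

module Comparison {m n : ℕ} (w : Node m n → ℕ) where
  open RationalFacts
  open import Data.Nat as ℕ using (_⊓_)
  import Data.Nat.Properties as ℕₚ
  open import Data.Nat.ListAction using (sum)
  open import Data.Integer as ℤ using (ℤ)
  import Data.Integer.Properties as ℤₚ
  open import Data.List using (map; length)
  open import Data.List.Properties using (length-filter)
  open import Data.List.Relation.Unary.Any using (here; there)
  open import Data.List.Membership.Propositional using (_∈_)
  open import Data.List.Membership.Propositional.Properties using (∈-filter⁺)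
  open import Data.Rational using (ℚ; 0ℚ; _≤_; _<_; _+_; _*_; NonNegative; positive)
  open import Data.Rational.Properties
  open Rounding w

  lighter-side : (f : Bool → ℕ) → Σ Bool λ b → f false ⊓ f true ≡ f b
  lighter-side f with ℕₚ.⊓-sel (f false) (f true)
  ... | inj₁ e = false , e
  ... | inj₂ e = true , e

  lighter-sideℤ : (f : Bool → ℤ) → Σ Bool λ b → f false ℤ.⊓ f true ≡ f b
  lighter-sideℤ f with ℤₚ.⊓-sel (f false) (f true)
  ... | inj₁ e = false , e
  ... | inj₂ e = true , e

  min≤side : (f : Bool → ℕ) → ∀ b → f false ⊓ f true ℕ.≤ f b
  min≤side f false = ℕₚ.m⊓n≤m (f false) (f true)
  min≤side f true = ℕₚ.m⊓n≤n (f false) (f true)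

  min≤sideℤ : (f : Bool → ℤ) → ∀ b → f false ℤ.⊓ f true ℤ.≤ f b
  min≤sideℤ f false = ℤₚ.i⊓j≤i (f false) (f true)
  min≤sideℤ f true = ℤₚ.i⊓j≤j (f false) (f true)

  element≤sum : ∀ {v xs} → v ∈ xs → w v ℕ.≤ sum (map w xs)
  element≤sum (here refl) = ℕₚ.m≤m+n _ _
  element≤sum {xs = y ∷ _} (there v∈xs) = ℕₚ.≤-trans (element≤sum v∈xs) (ℕₚ.m≤n+m _ (w y))

  side-positive : (∀ v → 0 ℕ.< w v) → ∀ (P : Bipartition m n) b v → P v ≡ b → 0 ℕ.< weightℕ w P b
  side-positive w>0 P b v Pv≡b =
    ℕₚ.≤-trans (w>0 v) (element≤sum (∈-filter⁺ (λ x → P x ≟B b) (∈-allNodes v) Pv≡b))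

  minWeight-positive : (∀ v → 0 ℕ.< w v) → ∀ V → ConnectedBipartition V →
    0ℚ < ℕtoℚ (minWeightℕ w V)
  minWeight-positive w>0 V (((v₀ , V₀) , _) , ((v₁ , V₁) , _)) = ℕtoℚ-positive
    (ℕₚ.⊓-glb (side-positive w>0 V false v₀ V₀) (side-positive w>0 V true v₁ V₁))

  rounding-comparison : (r : ℚ) (0<r : 0ℚ < r) (V V* : Bipartition m n) →
    minWeightℤ (rounded w r) V* ℤ.≤ minWeightℤ (rounded w r) V →
    ℕtoℚ (minWeightℕ w V*) ≤ ℕtoℚ (minWeightℕ w V) + r * ℕtoℚ (m ℕ.* n)
  rounding-comparison r 0<r V V* V*≤V = begin
    ℕtoℚ (minWeightℕ w V*)                         ≤⟨ ℕtoℚ-mono-≤ (min≤side (weightℕ w V*) c) ⟩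
    ℕtoℚ (weightℕ w V* c)                           ≤⟨ list-upper r 0<r (side V* c (allNodes m n)) ⟩
    r * fromℤ (weightℤ w' V* c) + r * ℕtoℚ (length (side V* c (allNodes m n)))
                                                    ≤⟨ +-monoʳ-≤ (r * fromℤ (weightℤ w' V* c)) few-nodes ⟩
    r * fromℤ (weightℤ w' V* c) + rN               ≡⟨ cong (λ z → r * fromℤ z + rN) (sym c-lighter) ⟩
    r * fromℤ (minWeightℤ w' V*) + rN              ≤⟨ +-monoˡ-≤ rN (*-monoˡ-≤-nonNeg r {{r≥0}} (fromℤ-mono-≤ V*≤Vb)) ⟩
    r * fromℤ (weightℤ w' V b) + rN                ≤⟨ +-monoˡ-≤ rN (list-lower r 0<r (side V b (allNodes m n))) ⟩
    ℕtoℚ (weightℕ w V b) + rN                      ≡⟨ cong (λ z → ℕtoℚ z + rN) (sym b-lighter) ⟩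
    ℕtoℚ (minWeightℕ w V) + rN                     ∎
    where
    open ≤-Reasoning
    w' = rounded w r
    r≥0 : NonNegative r
    r≥0 = pos⇒nonNeg r {{positive 0<r}}
    rN = r * ℕtoℚ (m ℕ.* n)
    -- c: the lighter side of V* for w'; b: the lighter side of V for w
    c = proj₁ (lighter-sideℤ (weightℤ w' V*))
    c-lighter = proj₂ (lighter-sideℤ (weightℤ w' V*))
    b = proj₁ (lighter-side (weightℕ w V))
    b-lighter = proj₂ (lighter-side (weightℕ w V))
    -- a side has at most N nodes
    few-nodes : r * ℕtoℚ (length (side V* c (allNodes m n))) ≤ rN
    few-nodes = *-monoˡ-≤-nonNeg r {{r≥0}} (ℕtoℚ-mono-≤
      (ℕₚ.≤-trans (length-filter _ (allNodes m n)) (ℕₚ.≤-reflexive (length-allNodes m n))))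
    V*≤Vb : minWeightℤ w' V* ℤ.≤ weightℤ w' V b
    V*≤Vb = ℤₚ.≤-trans V*≤V (min≤sideℤ (weightℤ w' V) b)

open import Data.Nat using (ℕ; _≤_; _<_; _*_; s≤s; z≤n)
open import Data.Integer using () renaming (_≤_ to _≤ℤ_)
open import Data.Rational using (ℚ; 0ℚ; 1ℚ; _-_) renaming (_<_ to _<ℚ_; _≤_ to _≤ℚ_)

lemma12 : (m n : ℕ) → 3 ≤ m → 3 ≤ n →
    (w : Node m n → ℕ) → ((v : Node m n) → 0 < w v) →
    ((v : Node m n) → 2 * w v < totalWeight w) →
    (ρ : ℚ) → 0ℚ <ℚ ρ → ρ <ℚ 1ℚ →
    (V V* : Bipartition m n) →
    ConnectedBipartition V →
    ((P : Bipartition m n) → ConnectedBipartition P →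
      minWeightℤ (rounded w (scale ρ (totalWeight w) (m * n))) P
        ≤ℤ minWeightℤ (rounded w (scale ρ (totalWeight w) (m * n))) V) →
    ConnectedBipartition V* →
    ((P : Bipartition m n) → ConnectedBipartition P →
      minWeightℕ w P ≤ minWeightℕ w V*) →
    divℚ (ℕtoℚ (minWeightℕ w V*)) (ℕtoℚ (minWeightℕ w V))
      ≤ℚ divℚ 1ℚ (1ℚ - ρ)
lemma12 (ℕ.suc m') (ℕ.suc n') (s≤s 2≤m') (s≤s 2≤n') w w>0 light ρ 0<ρ ρ<1
        V V* V-conn V-opt V*-conn V*-opt =
  ratio-bound (ℕtoℚ OPT) (ℕtoℚ (minWeightℕ w V)) (r Rat.* ℕtoℚ N) ρ
    (minWeight-positive w w>0 V V-conn) ρ<1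
    -- rounding costs at most r·N ...
    (rounding-comparison w r 0<r V V* (V-opt V* V*-conn))
    -- ... and r·N = ρW/3 ≤ ρ·OPT by the balanced cut
    (scale-bound ρ W N OPT (s≤s z≤n) 0<ρ W≤3·OPT)
  where
  import Data.Nat.Properties as ℕₚ
  import Data.Rational as Rat
  open RationalFacts
  open Comparison
  W = totalWeight w
  N = ℕ.suc m' * ℕ.suc n'
  OPT = minWeightℕ w V*
  r = scale ρ W N

  0<r : 0ℚ <ℚ r
  0<r = scale-positive ρ W N 0<ρ (ℕₚ.≤-trans (s≤s z≤n) (light (Fin.zero , Fin.zero))) (s≤s z≤n)

  -- OPT ≥ W/3, since OPT is at least as good as a balanced bipartition
  W≤3·OPT : W ≤ 3 * OPT
  W≤3·OPT = ℕₚ.≤-trans balanced (ℕₚ.*-monoʳ-≤ 3 (V*-opt P P-conn))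
    where
    open BalancedCut m' n' w
    B = balanced-bipartition (ℕₚ.≤-trans (s≤s z≤n) 2≤m') (ℕₚ.≤-trans (s≤s z≤n) 2≤n') light
    P = proj₁ B
    P-conn = proj₁ (proj₂ B)
    balanced = proj₂ (proj₂ B)
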